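{- A domain $D\subseteq\{0,1\}^n$ admits a $k$-ary StrongDem aggregator (for some $k\ge2$) if and only if it admits a ternary aggregator $F=(f_1,\ldots,f_n)$ such that $f_j\in\{\wedge^{(3)},\vee^{(3)},{\rm maj}\}$ for $j=1,\ldots,n$.
   Context: Standing assumption: domains are non-degenerate (projection onto each coordinate is $\{0,1\}$). A $k$-ary aggregator for $D$ is an $n$-tuple $(f_1,\ldots,f_n)$ of unanimous functions $f_j:\{0,1\}^k\to\{0,1\}$ such that whenever $x^1,\ldots,x^k\in D$, $(f_1(x^1_1,\ldots,x^k_1),\ldots,f_n(x^1_n,\ldots,x^k_n))\in D$. It is StrongDem if for every $j$ and every $i\in\{1,\ldots,k\}$ there exist $a_1,\ldots,a_{i-1},a_{i+1},\ldots,a_k\in\{0,1\}$ with $f_j(a_1,\ldots,a_{i-1},0,a_{i+1},\ldots,a_k)=f_j(a_1,\ldots,a_{i-1},1,a_{i+1},\ldots,a_k)$. The ternary operations are $\wedge^{(3)}(x,y,z)=x\wedge y\wedge z$, $\vee^{(3)}(x,y,z)=x\vee y\vee z$, and ${\rm maj}(x,y,z)=1$ iff at least two of $x,y,z$ equal 1. -}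

module Defs where

open import Data.Bool using (Bool; true; false; _∧_; _∨_)
open import Data.Nat using (ℕ)
open import Data.Fin using (Fin)
open import Data.Vec using (Vec; lookup; tabulate; updateAt; _[_]≔_)
open import Data.Product using (Σ; ∃; _×_; _,_)
open import Relation.Binary.PropositionalEquality using (_≡_)

Domain : ℕ → Set₁
Domain n = Vec Bool n → Set

NonDegenerate : ∀ {n} → Domain n → Set
NonDegenerate {n} D = ∀ (j : Fin n) (b : Bool) → Σ (Vec Bool n) λ x → D x × lookup x j ≡ b

Unanimous : ∀ {k} → (Vec Bool k → Bool) → Set
Unanimous {k} f = ∀ (b : Bool) → f (tabulate (λ _ → b)) ≡ b

apply : ∀ {n k} → (Fin n → Vec Bool k → Bool) → (Fin k → Vec Bool n) → Vec Bool n
apply F x = tabulate λ j → F j (tabulate λ i → lookup (x i) j)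

IsAggregator : ∀ {n} (k : ℕ) → Domain n → (Fin n → Vec Bool k → Bool) → Set
IsAggregator {n} k D F =
  (∀ j → Unanimous (F j)) ×
  (∀ (x : Fin k → Vec Bool n) → (∀ i → D (x i)) → D (apply F x))

StrongDem : ∀ {n k} → (Fin n → Vec Bool k → Bool) → Set
StrongDem {n} {k} F = ∀ (j : Fin n) (i : Fin k) →
  Σ (Vec Bool k) λ a → F j (a [ i ]≔ false) ≡ F j (a [ i ]≔ true)

and3 : Vec Bool 3 → Bool
and3 (x Data.Vec.∷ y Data.Vec.∷ z Data.Vec.∷ Data.Vec.[]) = x ∧ y ∧ z

or3 : Vec Bool 3 → Bool
or3 (x Data.Vec.∷ y Data.Vec.∷ z Data.Vec.∷ Data.Vec.[]) = x ∨ y ∨ z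

maj : Vec Bool 3 → Bool
maj (x Data.Vec.∷ y Data.Vec.∷ z Data.Vec.∷ Data.Vec.[]) = (x ∧ y) ∨ (y ∧ z) ∨ (x ∧ z)

data IsAndOrMaj (f : Vec Bool 3 → Bool) : Set where
  isAnd : (∀ v → f v ≡ and3 v) → IsAndOrMaj f
  isOr  : (∀ v → f v ≡ or3 v)  → IsAndOrMaj f
  isMaj : (∀ v → f v ≡ maj v)  → IsAndOrMaj f

-- Work in the clone generated by F, remembering which coordinates f_j are self-dual
-- (f(¬x) = ¬f(x)).  If f_j is not self-dual, f_j(S) = f_j(¬S) for some S, so a binary minor of f_j is
-- commutative, hence ∧ or ∨; plugging such minors into each other coordinate by coordinate gives one binary
-- term B that is commutative wherever F is not self-dual, while elsewhere B is self-dual, hence a projection.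
-- If f_j is self-dual, comparing a coordinate i where f_j is sensitive with the StrongDem witness for i
-- yields a ternary minor that is maj up to one negated argument, and substituting it into itself gives maj.
-- Since maj(a,a,b) = a, such terms merge coordinate by coordinate into one ternary M that is maj wherever
-- F is self-dual.  Finally M(T(x,y,z), T(y,z,x), T(z,x,y)) with T = B(B(x,y),z) is ∧, ∨ or maj on every
-- coordinate.  Conversely ∧, ∨ and maj are StrongDem.

module Submission where

open import Defs
open import Data.Bool using (Bool; true; false; not; _∧_; _∨_; if_then_else_)
open import Data.Bool.Properties using (∧-assoc; ∨-assoc; ¬-not; not-¬) renaming (_≟_ to _≟ᵇ_)
open import Data.Empty using (⊥; ⊥-elim)
open import Data.Fin using (Fin; zero; suc)
open import Data.Fin.Properties using (all?)
open import Data.Nat using (ℕ; zero; suc; _≥_; s≤s; z≤n)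
open import Data.Product using (Σ; ∃; _×_; _,_; proj₁; proj₂)
open import Data.Sum using (_⊎_; inj₁; inj₂)
open import Data.Vec using (Vec; []; _∷_; lookup; map; tabulate; replicate; _[_]≔_)
open import Data.Vec.Properties
  using (lookup∘tabulate; tabulate∘lookup; tabulate-cong; tabulate-∘; lookup-map; lookup-replicate;
         map-∘; map-cong; map-id; map-const; map-replicate; map-[]≔; []≔-lookup)
open import Function using (_∘_)
open import Function.Bundles using (_⇔_; mk⇔)
open import Relation.Nullary using (Dec; yes; no)
open import Relation.Nullary.Decidable using (map′; _×-dec_; _⊎-dec_; from-yes)
open import Relation.Binary.PropositionalEquality
  using (_≡_; _≢_; _≗_; refl; sym; trans; cong; cong₂; subst)
open import Algebra.Definitions (_≡_ {A = Bool}) using (Commutative)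

replicate≡tabulate : ∀ {A : Set} m (x : A) → replicate m x ≡ tabulate (λ _ → x)
replicate≡tabulate zero    x = refl
replicate≡tabulate (suc m) x = cong (x ∷_) (replicate≡tabulate m x)

tabulate-∘-lookup : ∀ {A B : Set} {m} (f : A → B) (xs : Vec A m) → tabulate (f ∘ lookup xs) ≡ map f xs
tabulate-∘-lookup f xs = trans (tabulate-∘ f (lookup xs)) (cong (map f) (tabulate∘lookup xs))

anyVec? : ∀ {m} {P : Vec Bool m → Set} → (∀ v → Dec (P v)) → Dec (∃ P)
anyVec? {zero} P? = map′ ([] ,_) (λ { ([] , p) → p }) (P? [])
anyVec? {suc m} P? =
  map′ (λ { (inj₁ (v , p)) → false ∷ v , p ; (inj₂ (v , p)) → true ∷ v , p })
       (λ { (false ∷ v , p) → inj₁ (v , p) ; (true ∷ v , p) → inj₂ (v , p) })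
       (anyVec? (λ v → P? (false ∷ v)) ⊎-dec anyVec? (λ v → P? (true ∷ v)))

infix 4 _≗?_
_≗?_ : ∀ {m} (g h : Vec Bool m → Bool) → Dec (g ≗ h)
_≗?_ {zero} g h = map′ (λ { e [] → e }) (λ e → e []) (g [] ≟ᵇ h [])
_≗?_ {suc m} g h =
  map′ (λ { (e₀ , e₁) (false ∷ v) → e₀ v ; (e₀ , e₁) (true ∷ v) → e₁ v })
       (λ e → (λ v → e (false ∷ v)) , (λ v → e (true ∷ v)))
       ((g ∘ (false ∷_) ≗? h ∘ (false ∷_)) ×-dec (g ∘ (true ∷_) ≗? h ∘ (true ∷_)))

improve-everywhere : ∀ {n} {C : Set} (Good : C → Fin n → Set) →
  (∀ c j → Σ C λ c′ → Good c′ j × (∀ i → Good c i → Good c′ i)) →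
  C → Σ C λ c → ∀ j → Good c j
improve-everywhere {zero}  Good improve c₀ = c₀ , λ ()
improve-everywhere {suc n} Good improve c₀
  with improve-everywhere (λ c j → Good c (suc j))
                          (λ c j → let c′ , now , keep = improve c (suc j) in c′ , now , λ i → keep (suc i)) c₀
... | c₁ , good with improve c₁ zero
... | c₂ , now , keep = c₂ , λ { zero → now ; (suc j) → keep (suc j) (good j) }

SelfDual : ∀ {m} → (Vec Bool m → Bool) → Set
SelfDual g = ∀ v → g (map not v) ≡ not (g v)

unit : ∀ {m} → Fin m → Vec Bool m
unit i = replicate _ false [ i ]≔ true

profile : ∀ {m} → (Vec Bool m → Bool) → Vec Bool m
profile g = tabulate (g ∘ unit)

binary : (Vec Bool 2 → Bool) → Bool → Bool → Bool
binary h x y = h (x ∷ y ∷ [])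

selfDual-or-coincides : ∀ {m} (g : Vec Bool m → Bool) → SelfDual g ⊎ ∃ λ v → g (map not v) ≡ g v
selfDual-or-coincides g with anyVec? (λ v → g (map not v) ≟ᵇ g v)
... | yes coincide = inj₂ coincide
... | no ¬coincide = inj₁ λ v → ¬-not λ e → ¬coincide (v , e)

coincides⇒¬selfDual : ∀ {m} {g : Vec Bool m → Bool} {v} → g (map not v) ≡ g v → SelfDual g → ⊥
coincides⇒¬selfDual {v = v} coincide sd = not-¬ refl (trans (sym coincide) (sd v))

unanimous-replicate : ∀ {m} {g : Vec Bool m → Bool} → Unanimous g → ∀ b → g (replicate m b) ≡ b
unanimous-replicate {m} {g} un b = trans (cong g (replicate≡tabulate m b)) (un b)

spike-diagonal : ∀ {m} {g : Vec Bool m → Bool} → Unanimous g → ∀ i a → g (replicate m a [ i ]≔ a) ≡ a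
spike-diagonal {m} {g} un i a =
  trans (cong (λ x → g (replicate m a [ i ]≔ x)) (sym (lookup-replicate i a)))
        (trans (cong g ([]≔-lookup (replicate m a) i)) (unanimous-replicate {g = g} un a))

spike-counit : ∀ {m} {g : Vec Bool m → Bool} → SelfDual g →
               ∀ i → g (replicate m true [ i ]≔ false) ≡ not (g (unit i))
spike-counit {m} {g} sd i =
  trans (cong g (sym (trans (map-[]≔ not (replicate m false) i)
                            (cong (_[ i ]≔ false) (map-replicate not false m)))))
        (sd (unit i))

absorbs-pivot : ∀ {m} {g : Vec Bool m → Bool} → Unanimous g → SelfDual g →
                ∀ {i} → g (unit i) ≡ true → ∀ a b → g (replicate m a [ i ]≔ b) ≡ b
absorbs-pivot {g = g} un sd {i} pivot false false = spike-diagonal {g = g} un i false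
absorbs-pivot {g = g} un sd {i} pivot true  true  = spike-diagonal {g = g} un i true
absorbs-pivot {g = g} un sd {i} pivot false true  = pivot
absorbs-pivot {g = g} un sd {i} pivot true  false = trans (spike-counit sd i) (cong not pivot)

absorbs-nonpivot : ∀ {m} {g : Vec Bool m → Bool} → Unanimous g → SelfDual g →
                   ∀ {i} → g (unit i) ≡ false → ∀ a b → g (replicate m a [ i ]≔ b) ≡ a
absorbs-nonpivot {g = g} un sd {i} nonpivot false false = spike-diagonal {g = g} un i false
absorbs-nonpivot {g = g} un sd {i} nonpivot true  true  = spike-diagonal {g = g} un i true
absorbs-nonpivot {g = g} un sd {i} nonpivot false true  = nonpivot
absorbs-nonpivot {g = g} un sd {i} nonpivot true  false = trans (spike-counit sd i) (cong not nonpivot)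

allFalse-or-pivot : ∀ {m} (w : Vec Bool m) → w ≡ replicate m false ⊎ Σ (Fin m) λ i → lookup w i ≡ true
allFalse-or-pivot []          = inj₁ refl
allFalse-or-pivot (true ∷ w)  = inj₂ (zero , refl)
allFalse-or-pivot (false ∷ w) with allFalse-or-pivot w
... | inj₁ allFalse   = inj₁ (cong (false ∷_) allFalse)
... | inj₂ (i , eqᵢ)  = inj₂ (suc i , eqᵢ)

unanimous⇒nonConstant : ∀ {m} {g : Vec Bool m → Bool} → Unanimous g →
                        g (tabulate λ _ → false) ≢ g (tabulate λ _ → true)
unanimous⇒nonConstant un e with trans (sym (un false)) (trans e (un true))
... | ()

≢⇒false≢true : ∀ (h : Bool → Bool) {a b} → h a ≢ h b → h false ≢ h true
≢⇒false≢true h {false} {false} ne = ⊥-elim (ne refl)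
≢⇒false≢true h {false} {true}  ne = ne
≢⇒false≢true h {true}  {false} ne = ne ∘ sym
≢⇒false≢true h {true}  {true}  ne = ⊥-elim (ne refl)

sensitiveCoordinate : ∀ {m} (g : Vec Bool m → Bool) {u w} → g u ≢ g w →
                      Σ (Vec Bool m) λ v → Σ (Fin m) λ i → g (v [ i ]≔ false) ≢ g (v [ i ]≔ true)
sensitiveCoordinate g {[]}    {[]}    ne = ⊥-elim (ne refl)
sensitiveCoordinate g {a ∷ u} {b ∷ w} ne with g (a ∷ u) ≟ᵇ g (a ∷ w)
... | no ne′ = let v , i , sensitive = sensitiveCoordinate (g ∘ (a ∷_)) ne′ in a ∷ v , suc i , sensitive
... | yes eq = a ∷ w , zero , ≢⇒false≢true (λ x → g (x ∷ w)) (ne ∘ trans eq)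

feedback : ∀ {m} → (Vec Bool m → Bool) → Fin m → Vec Bool m → Bool
feedback g i v = g (v [ i ]≔ g v)

fromProfile : Vec Bool 3 → Vec Bool 3 → Bool
fromProfile _                (false ∷ false ∷ false ∷ []) = false
fromProfile (p ∷ _ ∷ _ ∷ []) (true  ∷ false ∷ false ∷ []) = p
fromProfile (_ ∷ q ∷ _ ∷ []) (false ∷ true  ∷ false ∷ []) = q
fromProfile (_ ∷ _ ∷ r ∷ []) (false ∷ false ∷ true  ∷ []) = r
fromProfile (p ∷ _ ∷ _ ∷ []) (false ∷ true  ∷ true  ∷ []) = not p
fromProfile (_ ∷ q ∷ _ ∷ []) (true  ∷ false ∷ true  ∷ []) = not q
fromProfile (_ ∷ _ ∷ r ∷ []) (true  ∷ true  ∷ false ∷ []) = not r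
fromProfile _                (true  ∷ true  ∷ true  ∷ []) = true

selfDual-normalForm : ∀ {g : Vec Bool 3 → Bool} → Unanimous g → SelfDual g → g ≗ fromProfile (profile g)
selfDual-normalForm un sd (false ∷ false ∷ false ∷ []) = un false
selfDual-normalForm un sd (true  ∷ false ∷ false ∷ []) = refl
selfDual-normalForm un sd (false ∷ true  ∷ false ∷ []) = refl
selfDual-normalForm un sd (false ∷ false ∷ true  ∷ []) = refl
selfDual-normalForm un sd (false ∷ true  ∷ true  ∷ []) = sd (true ∷ false ∷ false ∷ [])
selfDual-normalForm un sd (true  ∷ false ∷ true  ∷ []) = sd (false ∷ true ∷ false ∷ [])
selfDual-normalForm un sd (true  ∷ true  ∷ false ∷ []) = sd (false ∷ false ∷ true ∷ [])
selfDual-normalForm un sd (true  ∷ true  ∷ true  ∷ []) = un true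

maj-unanimous : Unanimous maj
maj-unanimous false = refl
maj-unanimous true  = refl

maj-selfDual : SelfDual maj
maj-selfDual = from-yes (maj ∘ map not ≗? not ∘ maj)

maj-unit : ∀ i → maj (unit i) ≡ false
maj-unit zero             = refl
maj-unit (suc zero)       = refl
maj-unit (suc (suc zero)) = refl

maj-absorbs : ∀ i a b → maj (replicate 3 a [ i ]≔ b) ≡ a
maj-absorbs i = absorbs-nonpivot {g = maj} maj-unanimous maj-selfDual {i} (maj-unit i)

fromProfile-allFalse : fromProfile (replicate 3 false) ≗ maj
fromProfile-allFalse = from-yes (fromProfile (replicate 3 false) ≗? maj)

-- fromProfile (¬ unit i) is maj with its i-th argument negated; feeding it back into that argument repairs it.
fromProfile-negated : ∀ i → feedback (fromProfile (map not (unit i))) i ≗ maj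
fromProfile-negated = from-yes (all? λ i → feedback (fromProfile (map not (unit i))) i ≗? maj)

selfDual-allFalse⇒maj : ∀ {g : Vec Bool 3 → Bool} → Unanimous g → SelfDual g →
                        profile g ≡ replicate 3 false → g ≗ maj
selfDual-allFalse⇒maj un sd allFalse v =
  trans (selfDual-normalForm un sd v)
        (trans (cong (λ w → fromProfile w v) allFalse) (fromProfile-allFalse v))

selfDual-negated⇒maj : ∀ {g : Vec Bool 3 → Bool} → Unanimous g → SelfDual g →
                       ∀ {i} → profile g ≡ map not (unit i) → feedback g i ≗ maj
selfDual-negated⇒maj {g} un sd {i} negated v =
  trans (normal (v [ i ]≔ g v))
        (trans (cong (λ x → fromProfile (map not (unit i)) (v [ i ]≔ x)) (normal v)) (fromProfile-negated i v))
  where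
  normal : g ≗ fromProfile (map not (unit i))
  normal u = trans (selfDual-normalForm un sd u) (cong (λ w → fromProfile w u) negated)

NearMajority : Vec Bool 3 → Set
NearMajority w = w ≡ replicate 3 false ⊎ Σ (Fin 3) λ i → w ≡ map not (unit i)

nearMajority-sensitive : ∀ {c d} → c ≢ d → NearMajority (c ∷ false ∷ not d ∷ [])
nearMajority-sensitive {false} {false} ne = ⊥-elim (ne refl)
nearMajority-sensitive {false} {true}  _  = inj₁ refl
nearMajority-sensitive {true}  {false} _  = inj₂ (suc zero , refl)
nearMajority-sensitive {true}  {true}  ne = ⊥-elim (ne refl)

nearMajority-flat : ∀ {c d} → c ≡ d → NearMajority (c ∷ true ∷ not d ∷ [])
nearMajority-flat {false} refl = inj₂ (zero , refl)
nearMajority-flat {true}  refl = inj₂ (suc (suc zero) , refl)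

infixl 10 _⟨_⟩
_⟨_⟩ : ∀ {k m} → (Vec Bool k → Bool) → Vec (Fin m) k → Vec Bool m → Bool
(f ⟨ σ ⟩) v = f (map (lookup v) σ)

-- The minor f(…) reading its first argument where w is true, its second at i and its third where w is false.
spikeMinor : ∀ {k} → Vec Bool k → Fin k → Vec (Fin 3) k
spikeMinor w i = map (λ b → if b then zero else suc (suc zero)) w [ i ]≔ suc zero

spikeMinor-profile : ∀ {k} {f : Vec Bool k → Bool} → SelfDual f → ∀ w i {u} → f (unit i) ≡ u →
  profile (f ⟨ spikeMinor w i ⟩) ≡ f (w [ i ]≔ false) ∷ u ∷ not (f (w [ i ]≔ true)) ∷ []
spikeMinor-profile {f = f} sd w i fᵢ≡u =
  cong₂ _∷_ (cong f at-x) (cong₂ _∷_ (trans (cong f at-y) fᵢ≡u) (cong (_∷ []) (trans (cong f at-z) (sd _))))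
  where
  restrict : ∀ e → map (lookup e) (spikeMinor w i)
           ≡ map (λ b → lookup e (if b then zero else suc (suc zero))) w [ i ]≔ lookup e (suc zero)
  restrict e = trans (map-[]≔ (lookup e) _ i) (cong (_[ i ]≔ _) (sym (map-∘ (lookup e) _ w)))
  at-x : map (lookup (unit zero)) (spikeMinor w i) ≡ w [ i ]≔ false
  at-x = trans (restrict (unit zero))
               (cong (_[ i ]≔ false) (trans (map-cong (λ { true → refl ; false → refl }) w) (map-id w)))
  at-y : map (lookup (unit (suc zero))) (spikeMinor w i) ≡ unit i
  at-y = trans (restrict (unit (suc zero)))
               (cong (_[ i ]≔ true) (trans (map-cong (λ { true → refl ; false → refl }) w) (map-const w false)))
  at-z : map (lookup (unit (suc (suc zero)))) (spikeMinor w i) ≡ map not (w [ i ]≔ true)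
  at-z = trans (restrict (unit (suc (suc zero))))
               (trans (cong (_[ i ]≔ false) (map-cong (λ { true → refl ; false → refl }) w)) (sym (map-[]≔ not w i)))

-- The spike minor at a sensitive coordinate, or at the StrongDem witness for that coordinate, is near-majority,
-- according as f (unit i) is false or true.
nearMajorityMinor : ∀ {k} {f : Vec Bool k → Bool} → Unanimous f → SelfDual f →
  (∀ i → Σ (Vec Bool k) λ a → f (a [ i ]≔ false) ≡ f (a [ i ]≔ true)) →
  Σ (Vec (Fin 3) k) λ σ → NearMajority (profile (f ⟨ σ ⟩))
nearMajorityMinor {f = f} un sd strongDem with sensitiveCoordinate f (unanimous⇒nonConstant {g = f} un)
... | w , i , sensitive with f (unit i) in fᵢ
...   | false = spikeMinor w i ,
                subst NearMajority (sym (spikeMinor-profile sd w i fᵢ)) (nearMajority-sensitive sensitive)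
...   | true  = let a , flat = strongDem i in
                spikeMinor a i , subst NearMajority (sym (spikeMinor-profile sd a i fᵢ)) (nearMajority-flat flat)

swap-invariant⇒commutative : ∀ {h : Vec Bool 2 → Bool} →
                             h (false ∷ true ∷ []) ≡ h (true ∷ false ∷ []) → Commutative (binary h)
swap-invariant⇒commutative swap false false = refl
swap-invariant⇒commutative swap false true  = swap
swap-invariant⇒commutative swap true  false = sym swap
swap-invariant⇒commutative swap true  true  = refl

commutative⇒∧-or-∨ : ∀ {h : Vec Bool 2 → Bool} → Unanimous h → Commutative (binary h) →
                     (∀ x y → binary h x y ≡ x ∧ y) ⊎ (∀ x y → binary h x y ≡ x ∨ y)
commutative⇒∧-or-∨ {h} un comm with h (true ∷ false ∷ []) in h₁₀
... | false = inj₁ λ { false false → un false ; false true → trans (comm false true) h₁₀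
                     ; true false → h₁₀ ; true true → un true }
... | true  = inj₂ λ { false false → un false ; false true → trans (comm false true) h₁₀
                     ; true false → h₁₀ ; true true → un true }

selfDual⇒projection : ∀ {h : Vec Bool 2 → Bool} → Unanimous h → SelfDual h →
                      (∀ x y → binary h x y ≡ x) ⊎ (∀ x y → binary h x y ≡ y)
selfDual⇒projection {h} un sd with h (true ∷ false ∷ []) in h₁₀
... | true  = inj₁ λ { false false → un false ; false true → trans (sd _) (cong not h₁₀)
                     ; true false → h₁₀ ; true true → un true }
... | false = inj₂ λ { false false → un false ; false true → trans (sd _) (cong not h₁₀)
                     ; true false → h₁₀ ; true true → un true }

leftFold : (Vec Bool 2 → Bool) → Vec Bool 3 → Bool
leftFold h v = binary h (binary h (lookup v zero) (lookup v (suc zero))) (lookup v (suc (suc zero)))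

leftFold-≗ : ∀ {h} {_∙_ : Bool → Bool → Bool} → (∀ x y → binary h x y ≡ x ∙ y) →
             leftFold h ≗ λ v → (lookup v zero ∙ lookup v (suc zero)) ∙ lookup v (suc (suc zero))
leftFold-≗ {h} {_∙_} eq v = trans (eq _ _) (cong (_∙ _) (eq _ _))

leftFold-and3 : ∀ {h} → (∀ x y → binary h x y ≡ x ∧ y) → leftFold h ≗ and3
leftFold-and3 {h} eq v@(x ∷ y ∷ z ∷ []) = trans (leftFold-≗ {h} eq v) (∧-assoc x y z)

leftFold-or3 : ∀ {h} → (∀ x y → binary h x y ≡ x ∨ y) → leftFold h ≗ or3
leftFold-or3 {h} eq v@(x ∷ y ∷ z ∷ []) = trans (leftFold-≗ {h} eq v) (∨-assoc x y z)

rotate : Vec Bool 3 → Vec Bool 3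
rotate v = lookup v (suc zero) ∷ lookup v (suc (suc zero)) ∷ lookup v zero ∷ []

cyclicMean : (Vec Bool 3 → Bool) → (Vec Bool 3 → Bool) → Vec Bool 3 → Bool
cyclicMean g t v = g (t v ∷ t (rotate v) ∷ t (rotate (rotate v)) ∷ [])

cyclicMean-cong : ∀ {g g′ t t′} → g ≗ g′ → t ≗ t′ → cyclicMean g t ≗ cyclicMean g′ t′
cyclicMean-cong {g′ = g′} g≗g′ t≗t′ v =
  trans (g≗g′ _) (cong g′ (cong₂ _∷_ (t≗t′ _) (cong₂ _∷_ (t≗t′ _) (cong (_∷ []) (t≗t′ _)))))

cyclicMean-invariant : ∀ {g t} → Unanimous g → t ∘ rotate ≗ t → cyclicMean g t ≗ t
cyclicMean-invariant {g} {t} un inv v =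
  trans (cong (λ y → g (t v ∷ y)) (cong₂ _∷_ (inv v) (cong (_∷ []) (trans (inv (rotate v)) (inv v)))))
        (un (t v))

cyclicMean-maj-projection : ∀ i → cyclicMean maj (λ v → lookup v i) ≗ maj
cyclicMean-maj-projection = from-yes (all? λ i → cyclicMean maj (λ v → lookup v i) ≗? maj)

and3-rotate : and3 ∘ rotate ≗ and3
and3-rotate = from-yes (and3 ∘ rotate ≗? and3)

or3-rotate : or3 ∘ rotate ≗ or3
or3-rotate = from-yes (or3 ∘ rotate ≗? or3)

Op : ℕ → ℕ → Set
Op n m = Fin n → Vec Bool m → Bool

π : ∀ {n m} → Fin m → Op n m
π i _ v = lookup v i

infixr 9 _⊚_ _∘ᵒ_
_⊚_ : ∀ {m p} → (Vec Bool m → Bool) → (Fin m → Vec Bool p → Bool) → Vec Bool p → Bool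
(g ⊚ h) v = g (tabulate λ i → h i v)

_∘ᵒ_ : ∀ {n m p} → Op n m → (Fin m → Op n p) → Op n p
(G ∘ᵒ H) j = G j ⊚ λ i → H i j

⊚-unanimous : ∀ {m p} {g : Vec Bool m → Bool} {h : Fin m → Vec Bool p → Bool} →
              Unanimous g → (∀ i → Unanimous (h i)) → Unanimous (g ⊚ h)
⊚-unanimous {g = g} g-un h-un b = trans (cong g (tabulate-cong λ i → h-un i b)) (g-un b)

π-selfDual : ∀ {m} (i : Fin m) → SelfDual (λ v → lookup v i)
π-selfDual i v = lookup-map i not v

⊚-selfDual : ∀ {m p} {g : Vec Bool m → Bool} {h : Fin m → Vec Bool p → Bool} →
             SelfDual g → (∀ i → SelfDual (h i)) → SelfDual (g ⊚ h)
⊚-selfDual {g = g} {h} g-sd h-sd v =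
  trans (cong g (trans (tabulate-cong λ i → h-sd i v) (tabulate-∘ not λ i → h i v))) (g-sd _)

apply-π : ∀ {n m} (i : Fin m) (x : Fin m → Vec Bool n) → apply (π i) x ≡ x i
apply-π i x = trans (tabulate-cong λ j → lookup∘tabulate (λ i′ → lookup (x i′) j) i) (tabulate∘lookup (x i))

apply-∘ᵒ : ∀ {n m p} (G : Op n m) (H : Fin m → Op n p) (x : Fin p → Vec Bool n) →
           apply (G ∘ᵒ H) x ≡ apply G (λ i → apply (H i) x)
apply-∘ᵒ G H x = tabulate-cong λ j → cong (G j) (tabulate-cong λ i → sym (lookup∘tabulate _ j))

module _ {n} (D : Domain n) where

  π-isAggregator : ∀ {m} (i : Fin m) → IsAggregator m D (π i)
  π-isAggregator i = (λ _ b → lookup∘tabulate (λ _ → b) i) , λ x Dx → subst D (sym (apply-π i x)) (Dx i)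

  ∘ᵒ-isAggregator : ∀ {m p} {G : Op n m} {H : Fin m → Op n p} →
                    IsAggregator m D G → (∀ i → IsAggregator p D (H i)) → IsAggregator p D (G ∘ᵒ H)
  ∘ᵒ-isAggregator {G = G} {H} (G-un , G-pres) H-agg =
    (λ j → ⊚-unanimous {g = G j} {λ i → H i j} (G-un j) λ i → proj₁ (H-agg i) j) ,
    λ x Dx → subst D (sym (apply-∘ᵒ G H x)) (G-pres _ λ i → proj₂ (H-agg i) x Dx)

module Derivation {n k} (D : Domain n) (F : Op n k) (F-isAggregator : IsAggregator k D F) where

  record Admissible (m : ℕ) : Set where
    field
      op           : Op n m
      isAggregator : IsAggregator m D op
      selfDual     : ∀ j → SelfDual (F j) → SelfDual (op j)

    unanimous : ∀ j → Unanimous (op j)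
    unanimous = proj₁ isAggregator

  open Admissible

  F̂ : Admissible k
  F̂ = record { op = F ; isAggregator = F-isAggregator ; selfDual = λ _ sd → sd }

  proj : ∀ {m} → Fin m → Admissible m
  proj i = record { op = π i ; isAggregator = π-isAggregator D i ; selfDual = λ _ _ → π-selfDual i }

  infixl 9 _∘ₐ_
  _∘ₐ_ : ∀ {m p} → Admissible m → Vec (Admissible p) m → Admissible p
  G ∘ₐ Hs = record
    { op           = op G ∘ᵒ λ i → op (lookup Hs i)
    ; isAggregator = ∘ᵒ-isAggregator D {G = op G} {λ i → op (lookup Hs i)}
                                     (isAggregator G) λ i → isAggregator (lookup Hs i)
    ; selfDual     = λ j sd → ⊚-selfDual {g = op G j} {λ i → op (lookup Hs i) j}
                                         (selfDual G j sd) λ i → selfDual (lookup Hs i) j sd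
    }

  ∘ₐ-op : ∀ {m p} (G : Admissible m) (Hs : Vec (Admissible p) m) j v →
          op (G ∘ₐ Hs) j v ≡ op G j (map (λ H → op H j v) Hs)
  ∘ₐ-op G Hs j v = cong (op G j) (tabulate-∘-lookup (λ H → op H j v) Hs)

  minor : ∀ {m} → Vec (Fin m) k → Admissible m
  minor σ = F̂ ∘ₐ map proj σ

  minor-op : ∀ {m} (σ : Vec (Fin m) k) j → op (minor σ) j ≗ F j ⟨ σ ⟩
  minor-op σ j v = trans (∘ₐ-op F̂ (map proj σ) j v) (cong (F j) (sym (map-∘ _ proj σ)))

  binaryMinor : Vec Bool k → Admissible 2
  binaryMinor S = minor (map (λ b → if b then zero else suc zero) S)

  binaryMinor-commutative : ∀ {j S} → F j (map not S) ≡ F j S → Commutative (binary (op (binaryMinor S) j))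
  binaryMinor-commutative {j} {S} coincide =
    swap-invariant⇒commutative {op (binaryMinor S) j} (trans at-01 (trans coincide (sym at-10)))
    where
    at-10 : op (binaryMinor S) j (true ∷ false ∷ []) ≡ F j S
    at-10 = trans (minor-op _ j _)
                  (cong (F j) (trans (sym (map-∘ _ _ S))
                                     (trans (map-cong (λ { true → refl ; false → refl }) S) (map-id S))))
    at-01 : op (binaryMinor S) j (false ∷ true ∷ []) ≡ F j (map not S)
    at-01 = trans (minor-op _ j _)
                  (cong (F j) (trans (sym (map-∘ _ _ S)) (map-cong (λ { true → refl ; false → refl }) S)))

  swap : Admissible 2 → Admissible 2
  swap B = B ∘ₐ (proj (suc zero) ∷ proj zero ∷ [])

  symmetrize : Admissible 2 → Admissible 2 → Admissible 2
  symmetrize b B = b ∘ₐ (B ∷ swap B ∷ [])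

  symmetrize-commutativeˡ : ∀ b B j → Commutative (binary (op b j)) →
                            Commutative (binary (op (symmetrize b B) j))
  symmetrize-commutativeˡ b B j comm x y = comm (binary (op B j) x y) (binary (op B j) y x)

  symmetrize-commutativeʳ : ∀ b B j → Commutative (binary (op B j)) →
                            Commutative (binary (op (symmetrize b B) j))
  symmetrize-commutativeʳ b B j comm x y = trans (collapse x y) (trans (comm x y) (sym (collapse y x)))
    where
    collapse : ∀ x y → binary (op (symmetrize b B) j) x y ≡ binary (op B j) x y
    collapse x y = trans (cong (binary (op b j) (binary (op B j) x y)) (comm y x)) (unanimous b j _)

  CommutativeUnlessSelfDual : Admissible 2 → Fin n → Set
  CommutativeUnlessSelfDual B j = SelfDual (F j) ⊎ Commutative (binary (op B j))

  commutativeEverywhere : Σ (Admissible 2) λ B → ∀ j → CommutativeUnlessSelfDual B j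
  commutativeEverywhere = improve-everywhere CommutativeUnlessSelfDual improve (proj zero)
    where
    improve : ∀ B j → Σ (Admissible 2) λ B′ → CommutativeUnlessSelfDual B′ j ×
                                              (∀ i → CommutativeUnlessSelfDual B i → CommutativeUnlessSelfDual B′ i)
    improve B j with selfDual-or-coincides (F j)
    ... | inj₁ sd = B , inj₁ sd , λ _ good → good
    ... | inj₂ (S , coincide) =
          symmetrize (binaryMinor S) B ,
          inj₂ (symmetrize-commutativeˡ (binaryMinor S) B j (binaryMinor-commutative coincide)) ,
          λ { i (inj₁ sd) → inj₁ sd ; i (inj₂ comm) → inj₂ (symmetrize-commutativeʳ (binaryMinor S) B i comm) }

  feedbackₐ : ∀ {m} → Fin m → Admissible m → Admissible m
  feedbackₐ i t = t ∘ₐ (tabulate proj [ i ]≔ t)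

  feedbackₐ-op : ∀ {m} (i : Fin m) t j → op (feedbackₐ i t) j ≗ feedback (op t j) i
  feedbackₐ-op {m} i t j v =
    trans (∘ₐ-op t _ j v)
          (cong (op t j) (trans (map-[]≔ at-v (tabulate proj) i)
                                (cong (_[ i ]≔ op t j v)
                                      (trans (sym (tabulate-∘ at-v proj)) (tabulate∘lookup v)))))
    where
    at-v : Admissible m → Bool
    at-v H = op H j v

  spikeₐ : ∀ {m} → Fin m → Admissible m → Admissible m → Admissible m
  spikeₐ i M N = M ∘ₐ (replicate _ M [ i ]≔ N)

  spikeₐ-op : ∀ {m} (i : Fin m) M N j v →
              op (spikeₐ i M N) j v ≡ op M j (replicate m (op M j v) [ i ]≔ op N j v)
  spikeₐ-op {m} i M N j v =
    trans (∘ₐ-op M _ j v)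
          (cong (op M j) (trans (map-[]≔ at-v (replicate m M) i)
                                (cong (_[ i ]≔ op N j v) (map-replicate at-v M m))))
    where
    at-v : Admissible m → Bool
    at-v H = op H j v

  MajorityIfSelfDual : Admissible 3 → Fin n → Set
  MajorityIfSelfDual M j = SelfDual (F j) → op M j ≗ maj

  majorityAt : ∀ j → SelfDual (F j) →
               (∀ i → Σ (Vec Bool k) λ a → F j (a [ i ]≔ false) ≡ F j (a [ i ]≔ true)) →
               Σ (Admissible 3) λ N → op N j ≗ maj
  majorityAt j sd strongDem with nearMajorityMinor {f = F j} (unanimous F̂ j) sd strongDem
  ... | σ , near with subst NearMajority (tabulate-cong λ i → sym (minor-op σ j (unit i))) near
  ...   | inj₁ allFalse =
          minor σ , selfDual-allFalse⇒maj (unanimous (minor σ) j) (selfDual (minor σ) j sd) allFalse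
  ...   | inj₂ (i , negated) =
          feedbackₐ i (minor σ) ,
          λ v → trans (feedbackₐ-op i (minor σ) j v)
                      (selfDual-negated⇒maj (unanimous (minor σ) j) (selfDual (minor σ) j sd) negated v)

  absorbMajority : ∀ (M N : Admissible 3) j → SelfDual (F j) → op N j ≗ maj →
                   Σ (Admissible 3) λ M′ → op M′ j ≗ maj × (∀ i → op M i ≗ maj → op M′ i ≗ maj)
  absorbMajority M N j sd N-maj with allFalse-or-pivot (profile (op M j))
  ... | inj₁ allFalse = M , selfDual-allFalse⇒maj (unanimous M j) (selfDual M j sd) allFalse , λ _ M-maj → M-maj
  ... | inj₂ (i , pivot) = spikeₐ i M N , at-j , λ i′ M-maj v →
        trans (spikeₐ-op i M N i′ v) (trans (M-maj _) (trans (maj-absorbs i _ _) (M-maj v)))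
    where
    at-j : op (spikeₐ i M N) j ≗ maj
    at-j v = trans (spikeₐ-op i M N j v)
                   (trans (absorbs-pivot {g = op M j} (unanimous M j) (selfDual M j sd)
                                         (trans (sym (lookup∘tabulate (op M j ∘ unit) i)) pivot) _ _)
                          (N-maj v))

  majorityEverywhere : StrongDem F → Σ (Admissible 3) λ M → ∀ j → MajorityIfSelfDual M j
  majorityEverywhere strongDem = improve-everywhere MajorityIfSelfDual improve (proj zero)
    where
    improve : ∀ M j → Σ (Admissible 3) λ M′ → MajorityIfSelfDual M′ j × (∀ i → MajorityIfSelfDual M i → MajorityIfSelfDual M′ i)
    improve M j with selfDual-or-coincides (F j)
    ... | inj₂ (_ , coincide) = M , (λ sd → ⊥-elim (coincides⇒¬selfDual coincide sd)) , λ _ good → good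
    ... | inj₁ sd = let N , N-maj = majorityAt j sd (strongDem j)
                        M′ , now , keep = absorbMajority M N j sd N-maj
                    in M′ , (λ _ → now) , λ i good sdᵢ → keep i (good sdᵢ)

  leftFoldₐ : Admissible 2 → Admissible 3
  leftFoldₐ B = B ∘ₐ (B ∘ₐ (proj zero ∷ proj (suc zero) ∷ []) ∷ proj (suc (suc zero)) ∷ [])

  rotateₐ : Admissible 3 → Admissible 3
  rotateₐ T = T ∘ₐ (proj (suc zero) ∷ proj (suc (suc zero)) ∷ proj zero ∷ [])

  cyclicMeanₐ : Admissible 3 → Admissible 3 → Admissible 3
  cyclicMeanₐ M T = M ∘ₐ (T ∷ rotateₐ T ∷ rotateₐ (rotateₐ T) ∷ [])

  cyclicMeanₐ-isAndOrMaj : ∀ {B M} j → CommutativeUnlessSelfDual B j → MajorityIfSelfDual M j →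
                           IsAndOrMaj (op (cyclicMeanₐ M (leftFoldₐ B)) j)
  cyclicMeanₐ-isAndOrMaj {B} {M} j (inj₂ comm) _ with commutative⇒∧-or-∨ {op B j} (unanimous B j) comm
  ... | inj₁ is-∧ = isAnd λ v → trans (cyclicMean-cong {op M j} (λ _ → refl) (leftFold-and3 {op B j} is-∧) v)
                                      (cyclicMean-invariant {op M j} (unanimous M j) and3-rotate v)
  ... | inj₂ is-∨ = isOr λ v → trans (cyclicMean-cong {op M j} (λ _ → refl) (leftFold-or3 {op B j} is-∨) v)
                                     (cyclicMean-invariant {op M j} (unanimous M j) or3-rotate v)
  cyclicMeanₐ-isAndOrMaj {B} {M} j (inj₁ sd) M-maj
    with selfDual⇒projection {op B j} (unanimous B j) (selfDual B j sd)
  ... | inj₁ first = isMaj λ v → trans (cyclicMean-cong (M-maj sd) (leftFold-≗ {op B j} first) v)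
                                       (cyclicMean-maj-projection zero v)
  ... | inj₂ last  = isMaj λ v → trans (cyclicMean-cong (M-maj sd) (leftFold-≗ {op B j} last) v)
                                       (cyclicMean-maj-projection (suc (suc zero)) v)

  forward : StrongDem F → Σ (Op n 3) λ G → IsAggregator 3 D G × (∀ j → IsAndOrMaj (G j))
  forward strongDem =
    let B , commutative = commutativeEverywhere
        M , majority    = majorityEverywhere strongDem
        A               = cyclicMeanₐ M (leftFoldₐ B)
    in op A , isAggregator A , λ j → cyclicMeanₐ-isAndOrMaj {B} {M} j (commutative j) (majority j)

flatAt? : (g : Vec Bool 3 → Bool) (a : Vec Bool 3) → Dec (∀ i → g (a [ i ]≔ false) ≡ g (a [ i ]≔ true))
flatAt? g a = all? λ i → g (a [ i ]≔ false) ≟ᵇ g (a [ i ]≔ true)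

≗-transfer : ∀ {f g : Vec Bool 3 → Bool} {u w} → f ≗ g → g u ≡ g w → f u ≡ f w
≗-transfer f≗g eq = trans (f≗g _) (trans eq (sym (f≗g _)))

andOrMaj-strongDem : ∀ {f} → IsAndOrMaj f →
                     ∀ i → Σ (Vec Bool 3) λ a → f (a [ i ]≔ false) ≡ f (a [ i ]≔ true)
andOrMaj-strongDem (isAnd f≗) i = replicate 3 false , ≗-transfer f≗ (from-yes (flatAt? and3 (replicate 3 false)) i)
andOrMaj-strongDem (isOr f≗)  i = replicate 3 true  , ≗-transfer f≗ (from-yes (flatAt? or3 (replicate 3 true)) i)
andOrMaj-strongDem (isMaj f≗) i = replicate 3 false , ≗-transfer f≗ (from-yes (flatAt? maj (replicate 3 false)) i)

theorem5p21 : ∀ (n : ℕ) (D : Domain n) → NonDegenerate D →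
    (Σ ℕ λ k → k ≥ 2 × Σ (Fin n → Vec Bool k → Bool) λ F → IsAggregator k D F × StrongDem F)
    ⇔ (Σ (Fin n → Vec Bool 3 → Bool) λ F → IsAggregator 3 D F × (∀ j → IsAndOrMaj (F j)))
theorem5p21 n D _ = mk⇔
  (λ { (k , _ , F , F-isAggregator , strongDem) → Derivation.forward D F F-isAggregator strongDem })
  (λ { (G , G-isAggregator , shapes) →
       3 , s≤s (s≤s z≤n) , G , G-isAggregator , λ j → andOrMaj-strongDem (shapes j) })
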